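{- Let $G_1$ and $G_2$ be vertex-disjoint finite connected graphs with $n_1$ and $n_2$ vertices and distance matrices $D_1,D_2$, and suppose $D_iw_i=n_i\cdot\mathbf{1}$ for some $w_i\in\mathbb{R}^{n_i}_{\geq 0}$, $i=1,2$. Let $u\in V(G_1)$, $v\in V(G_2)$, and let $H$ be the graph obtained by adding the edge $\{u,v\}$ between $G_1$ and $G_2$ and then contracting this edge (equivalently, identifying $u$ and $v$ into a single vertex $c$), so $H$ has $n_1+n_2-1$ vertices. Then $H$ has a curvature $w$, i.e. $D_Hw=(n_1+n_2-1)\cdot\mathbf{1}$ with $D_H$ the distance matrix of $H$, such that $w(x)\geq 0$ for every vertex $x\neq c$ of $H$.
   Context: For a finite connected graph with vertices $v_1,\dots,v_m$, the distance matrix is $D_{ij}=d(v_i,v_j)$ (shortest-path distance), $\mathbf{1}$ is the all-ones vector, and a curvature is a vector $w\in\mathbb{R}^m$, viewed as a function on vertices, with $Dw=m\cdot\mathbf{1}$.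
   Formalization: The nonnegative curvatures $w_i$ of $G_1$ and $G_2$ have rational entries rather than real ones, and the curvature $w$ of $H$ is taken in the rationals. -}

module Defs where

open import Data.Nat using (ℕ; zero; suc; _≤_; _+_)
open import Data.Fin using (Fin; splitAt; punchIn; _↑ˡ_) renaming (_≟_ to _≟ᶠ_)
open import Data.Bool using (Bool; true; false; _∧_)
open import Data.Sum using (inj₁; inj₂)
open import Data.Product using (_×_; ∃)
open import Data.Integer using (+_)
open import Data.Rational using (ℚ; 0ℚ) renaming (_+_ to _+ℚ_; _*_ to _*ℚ_; _/_ to _/ℚ_)
open import Relation.Nullary using (does)
open import Relation.Binary.PropositionalEquality using (_≡_)

record Graph (n : ℕ) : Set where
  constructor mkGraph
  field
    adj : Fin n → Fin n → Bool
open Graph public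

IsSimple : ∀ {n} → Graph n → Set
IsSimple G = (∀ x y → adj G x y ≡ adj G y x) × (∀ x → adj G x x ≡ false)

data Walk {n : ℕ} (G : Graph n) : Fin n → Fin n → ℕ → Set where
  here : ∀ x → Walk G x x 0
  step : ∀ {x y z k} → adj G x y ≡ true → Walk G y z k → Walk G x z (suc k)

Connected : ∀ {n} → Graph n → Set
Connected G = ∀ x y → ∃ λ k → Walk G x y k

IsDistance : ∀ {n} → Graph n → Fin n → Fin n → ℕ → Set
IsDistance G x y d = Walk G x y d × (∀ k → Walk G x y k → d ≤ k)

IsDistanceMatrix : ∀ {n} → Graph n → (Fin n → Fin n → ℕ) → Set
IsDistanceMatrix G D = ∀ x y → IsDistance G x y (D x y)

ℕtoℚ : ℕ → ℚ
ℕtoℚ k = + k /ℚ 1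

sumℚ : ∀ {n} → (Fin n → ℚ) → ℚ
sumℚ {zero}  f = 0ℚ
sumℚ {suc n} f = f Fin.zero +ℚ sumℚ (λ i → f (Fin.suc i))

IsCurvature : ∀ {n} → (Fin n → Fin n → ℕ) → (Fin n → ℚ) → Set
IsCurvature {n} D w = ∀ i → sumℚ (λ j → ℕtoℚ (D i j) *ℚ w j) ≡ ℕtoℚ n

-- Vertex set Fin (n₁ + m), where
-- the first n₁ vertices are those of G₁ (u playing the role of c), and the
-- remaining m are the vertices of G₂ other than v, listed via punchIn v.
glue : ∀ {n₁ m} → Graph n₁ → Graph (suc m) → Fin n₁ → Fin (suc m) → Graph (n₁ + m)
glue {n₁} {m} G₁ G₂ u v = mkGraph A
  where
  A : Fin (n₁ + m) → Fin (n₁ + m) → Bool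
  A x y with splitAt n₁ x | splitAt n₁ y
  ... | inj₁ a | inj₁ b = adj G₁ a b
  ... | inj₂ a | inj₂ b = adj G₂ (punchIn v a) (punchIn v b)
  ... | inj₁ a | inj₂ b = does (a ≟ᶠ u) ∧ adj G₂ v (punchIn v b)
  ... | inj₂ a | inj₁ b = does (b ≟ᶠ u) ∧ adj G₂ (punchIn v a) v

glueVertex : ∀ {n₁} m → Fin n₁ → Fin (n₁ + m)
glueVertex m u = u ↑ˡ m

{-# OPTIONS --safe #-}
module Submission where

-- H is the one-point union of G₁ and G₂ at c.  Let π₁ : H → G₁ and π₂ : H → G₂ be the
-- retractions collapsing the other side onto c.  Every geodesic between the two sides
-- passes through c, so d_H(s, t) = d₁(π₁ s, π₁ t) + d₂(π₂ s, π₂ t), and therefore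
-- D_H w = (D₁ (π₁)₊w) ∘ π₁ + (D₂ (π₂)₊w) ∘ π₂.  It thus suffices to find w whose
-- pushforwards are α w₁ and β w₂ with α n₁ + β n₂ = n₁ + n₂ - 1.  Such a w exists as soon
-- as the total masses α Σw₁ and β Σw₂ agree: keep α w₁ on G₁ - c and β w₂ on G₂ - c, and
-- correct the weight at c.  Taking (α, β) proportional to (Σw₂, Σw₁), the correction at c
-- is the only possibly negative value.

open import Defs
open import Data.Bool using (Bool; true; false; _∧_; if_then_else_)
open import Data.Fin using (Fin; zero; suc; splitAt; join; punchIn; punchOut) renaming (_≟_ to _≟ᶠ_)
open import Data.Fin.Properties
  using (splitAt-join; join-splitAt; splitAt⁻¹-↑ˡ; punchInᵢ≢i; punchIn-punchOut; punchOut-punchIn; punchOut-cong)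
import Data.Nat as ℕ
open import Data.Nat using (ℕ; zero; suc)
open import Data.Product using (_×_; _,_; proj₁; proj₂; ∃)
open import Data.Sum using (_⊎_; inj₁; inj₂)
open import Function using (_∘_)
open import Relation.Nullary using (yes; no; does; contradiction)
open import Relation.Nullary.Decidable using (dec-true; dec-false)
open import Relation.Binary.PropositionalEquality

module Walks where
  open import Data.Nat using (_+_; _≤_; s≤s)
  open import Data.Nat.Properties using (≤-trans; ≤-antisym; ≤-reflexive; n≤0⇒n≡0)

  _++ʷ_ : ∀ {n} {G : Graph n} {x y z k l} → Walk G x y k → Walk G y z l → Walk G x z (k + l)
  here _   ++ʷ q = q
  step e p ++ʷ q = step e (p ++ʷ q)

  mapʷ : ∀ {n n′} {G : Graph n} {H : Graph n′} (f : Fin n → Fin n′) →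
         (∀ {x y} → adj G x y ≡ true → adj H (f x) (f y) ≡ true) →
         ∀ {x y k} → Walk G x y k → Walk H (f x) (f y) k
  mapʷ f hom (here x)   = here (f x)
  mapʷ f hom (step e p) = step (hom e) (mapʷ f hom p)

  module _ {n} {G : Graph n} {D : Fin n → Fin n → ℕ} (isD : IsDistanceMatrix G D) where

    distance-diagonal : ∀ x → D x x ≡ 0
    distance-diagonal x = n≤0⇒n≡0 (proj₂ (isD x x) 0 (here x))

    distance-step : ∀ {x y} z → adj G x y ≡ true → D x z ≤ suc (D y z)
    distance-step {x} {y} z e = proj₂ (isD x z) _ (step e (proj₁ (isD y z)))

  module _ {n} {G : Graph n} (d : Fin n → Fin n → ℕ) (d-diagonal : ∀ x → d x x ≡ 0)
           (d-step : ∀ {x y} z → adj G x y ≡ true → d x z ≤ suc (d y z)) where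

    walk-length-bound : ∀ {x y k} → Walk G x y k → d x y ≤ k
    walk-length-bound (here x)   = ≤-reflexive (d-diagonal x)
    walk-length-bound (step e p) = ≤-trans (d-step _ e) (s≤s (walk-length-bound p))

    isDistanceMatrix : (∀ x y → Walk G x y (d x y)) → IsDistanceMatrix G d
    isDistanceMatrix geodesic x y = geodesic x y , λ _ → walk-length-bound

  distanceMatrix-unique : ∀ {n} {G : Graph n} {D D′ : Fin n → Fin n → ℕ} →
    IsDistanceMatrix G D → IsDistanceMatrix G D′ → ∀ x y → D x y ≡ D′ x y
  distanceMatrix-unique isD isD′ x y =
    ≤-antisym (proj₂ (isD x y) _ (proj₁ (isD′ x y))) (proj₂ (isD′ x y) _ (proj₁ (isD x y)))

-- Vertices of the glued graph, as split by splitAt n₁: inj₁ a stands for a ∈ G₁ (so inj₁ u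
-- is c) and inj₂ b for punchIn v b ∈ G₂ - v.
module Wedge {n₁ m : ℕ} (u : Fin n₁) (v : Fin (suc m)) where

  π₁ : Fin n₁ ⊎ Fin m → Fin n₁
  π₁ (inj₁ a) = a
  π₁ (inj₂ _) = u

  π₂ : Fin n₁ ⊎ Fin m → Fin (suc m)
  π₂ (inj₁ _) = v
  π₂ (inj₂ b) = punchIn v b

  ι₂ : Fin (suc m) → Fin n₁ ⊎ Fin m
  ι₂ y with v ≟ᶠ y
  ... | yes _   = inj₁ u
  ... | no v≢y = inj₂ (punchOut v≢y)

  ι₂-v : ι₂ v ≡ inj₁ u
  ι₂-v with v ≟ᶠ v
  ... | yes _   = refl
  ... | no v≢v = contradiction refl v≢v

  ι₂-punchIn : ∀ b → ι₂ (punchIn v b) ≡ inj₂ b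
  ι₂-punchIn b with v ≟ᶠ punchIn v b
  ... | yes v≡b = contradiction (sym v≡b) (punchInᵢ≢i v b)
  ... | no _    = cong inj₂ (trans (punchOut-cong v refl) (punchOut-punchIn v))

  v-or-punchIn : ∀ y → v ≡ y ⊎ ∃ λ b → punchIn v b ≡ y
  v-or-punchIn y with v ≟ᶠ y
  ... | yes v≡y = inj₁ v≡y
  ... | no v≢y  = inj₂ (punchOut v≢y , punchIn-punchOut v≢y)

  wedgeDist : (Fin n₁ → Fin n₁ → ℕ) → (Fin (suc m) → Fin (suc m) → ℕ) →
              Fin n₁ ⊎ Fin m → Fin n₁ ⊎ Fin m → ℕ
  wedgeDist D₁ D₂ s t = D₁ (π₁ s) (π₁ t) ℕ.+ D₂ (π₂ s) (π₂ t)

module GlueDistance {n₁ m : ℕ} (G₁ : Graph n₁) (G₂ : Graph (suc m)) (u : Fin n₁) (v : Fin (suc m)) where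
  open import Data.Nat using (_+_; _≤_)
  open import Data.Nat.Properties using (≤-trans; ≤-reflexive; +-monoˡ-≤; +-monoʳ-≤; +-suc; +-identityʳ; +-comm)
  open Walks
  open Wedge u v

  H : Graph (n₁ + m)
  H = glue G₁ G₂ u v

  adjᵂ : Fin n₁ ⊎ Fin m → Fin n₁ ⊎ Fin m → Bool
  adjᵂ (inj₁ a) (inj₁ b) = adj G₁ a b
  adjᵂ (inj₂ a) (inj₂ b) = adj G₂ (punchIn v a) (punchIn v b)
  adjᵂ (inj₁ a) (inj₂ b) = does (a ≟ᶠ u) ∧ adj G₂ v (punchIn v b)
  adjᵂ (inj₂ a) (inj₁ b) = does (b ≟ᶠ u) ∧ adj G₂ (punchIn v a) v

  adj-glue : ∀ p q → adj H p q ≡ adjᵂ (splitAt n₁ p) (splitAt n₁ q)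
  adj-glue p q with splitAt n₁ p | splitAt n₁ q
  ... | inj₁ a | inj₁ b = refl
  ... | inj₁ a | inj₂ b = refl
  ... | inj₂ a | inj₁ b = refl
  ... | inj₂ a | inj₂ b = refl

  adj-glue-join : ∀ s t → adj H (join n₁ m s) (join n₁ m t) ≡ adjᵂ s t
  adj-glue-join s t = trans (adj-glue _ _) (cong₂ adjᵂ (splitAt-join n₁ m s) (splitAt-join n₁ m t))

  edge-moves-one-side : ∀ {s t} → adjᵂ s t ≡ true →
    (adj G₁ (π₁ s) (π₁ t) ≡ true × π₂ s ≡ π₂ t) ⊎ (π₁ s ≡ π₁ t × adj G₂ (π₂ s) (π₂ t) ≡ true)
  edge-moves-one-side {inj₁ a} {inj₁ b} e = inj₁ (e , refl)
  edge-moves-one-side {inj₂ a} {inj₂ b} e = inj₂ (refl , e)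
  edge-moves-one-side {inj₁ a} {inj₂ b} e with a ≟ᶠ u
  ... | yes refl = inj₂ (refl , e)
  edge-moves-one-side {inj₁ a} {inj₂ b} () | no _
  edge-moves-one-side {inj₂ a} {inj₁ b} e with b ≟ᶠ u
  ... | yes refl = inj₂ (refl , e)
  edge-moves-one-side {inj₂ a} {inj₁ b} () | no _

  ι₂-hom : (∀ x → adj G₂ x x ≡ false) → ∀ {x y} → adj G₂ x y ≡ true → adjᵂ (ι₂ x) (ι₂ y) ≡ true
  ι₂-hom loopless {x} {y} e with v-or-punchIn x | v-or-punchIn y
  ... | inj₁ refl       | inj₁ refl       = contradiction (trans (sym e) (loopless v)) λ ()
  ... | inj₁ refl       | inj₂ (b , refl)
      rewrite ι₂-v | ι₂-punchIn b | dec-true (u ≟ᶠ u) refl = e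
  ... | inj₂ (a , refl) | inj₁ refl
      rewrite ι₂-v | ι₂-punchIn a | dec-true (u ≟ᶠ u) refl = e
  ... | inj₂ (a , refl) | inj₂ (b , refl)
      rewrite ι₂-punchIn a | ι₂-punchIn b = e

  module _ (loopless₂ : ∀ x → adj G₂ x x ≡ false)
           {D₁ : Fin n₁ → Fin n₁ → ℕ} (isD₁ : IsDistanceMatrix G₁ D₁)
           {D₂ : Fin (suc m) → Fin (suc m) → ℕ} (isD₂ : IsDistanceMatrix G₂ D₂) where

    wedgeDist-diagonal : ∀ s → wedgeDist D₁ D₂ s s ≡ 0
    wedgeDist-diagonal s = cong₂ _+_ (distance-diagonal isD₁ (π₁ s)) (distance-diagonal isD₂ (π₂ s))

    wedgeDist-step : ∀ {s t} r → adjᵂ s t ≡ true → wedgeDist D₁ D₂ s r ≤ suc (wedgeDist D₁ D₂ t r)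
    wedgeDist-step {s} {t} r e with edge-moves-one-side {s} {t} e
    ... | inj₁ (e₁ , π₂s≡π₂t) rewrite π₂s≡π₂t = +-monoˡ-≤ _ (distance-step isD₁ (π₁ r) e₁)
    ... | inj₂ (π₁s≡π₁t , e₂) rewrite π₁s≡π₁t =
      ≤-trans (+-monoʳ-≤ _ (distance-step isD₂ (π₂ r) e₂)) (≤-reflexive (+-suc _ _))

    walk₁ : ∀ {a b k} → Walk G₁ a b k → Walk H (join n₁ m (inj₁ a)) (join n₁ m (inj₁ b)) k
    walk₁ = mapʷ (join n₁ m ∘ inj₁) (λ {a} {b} e → trans (adj-glue-join (inj₁ a) (inj₁ b)) e)

    walk₂ : ∀ {s t x y k} → ι₂ x ≡ s → ι₂ y ≡ t → Walk G₂ x y k → Walk H (join n₁ m s) (join n₁ m t) k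
    walk₂ refl refl =
      mapʷ (join n₁ m ∘ ι₂) (λ {x} {y} e → trans (adj-glue-join (ι₂ x) (ι₂ y)) (ι₂-hom loopless₂ e))

    wedge-geodesic : ∀ s t → Walk H (join n₁ m s) (join n₁ m t) (wedgeDist D₁ D₂ s t)
    wedge-geodesic (inj₁ a) (inj₁ b) =
      subst (Walk H _ _) (sym (trans (cong (D₁ a b +_) (distance-diagonal isD₂ v)) (+-identityʳ _)))
        (walk₁ (proj₁ (isD₁ a b)))
    wedge-geodesic (inj₁ a) (inj₂ b) =
      walk₁ (proj₁ (isD₁ a u)) ++ʷ walk₂ ι₂-v (ι₂-punchIn b) (proj₁ (isD₂ v (punchIn v b)))
    wedge-geodesic (inj₂ a) (inj₁ b) =
      subst (Walk H _ _) (+-comm (D₂ (punchIn v a) v) (D₁ u b))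
        (walk₂ (ι₂-punchIn a) ι₂-v (proj₁ (isD₂ (punchIn v a) v)) ++ʷ walk₁ (proj₁ (isD₁ u b)))
    wedge-geodesic (inj₂ a) (inj₂ b) =
      subst (Walk H _ _) (cong (_+ _) (sym (distance-diagonal isD₁ u)))
        (walk₂ (ι₂-punchIn a) (ι₂-punchIn b) (proj₁ (isD₂ (punchIn v a) (punchIn v b))))

    glue-isDistanceMatrix : IsDistanceMatrix H (λ p q → wedgeDist D₁ D₂ (splitAt n₁ p) (splitAt n₁ q))
    glue-isDistanceMatrix = isDistanceMatrix _
      (λ p → wedgeDist-diagonal (splitAt n₁ p))
      (λ {p} {q} r e → wedgeDist-step {splitAt n₁ p} {splitAt n₁ q} (splitAt n₁ r)
                                      (trans (sym (adj-glue p q)) e))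
      geodesic
      where
      geodesic : ∀ p q → Walk H p q (wedgeDist D₁ D₂ (splitAt n₁ p) (splitAt n₁ q))
      geodesic p q = subst₂ (λ p′ q′ → Walk H p′ q′ (wedgeDist D₁ D₂ (splitAt n₁ p) (splitAt n₁ q)))
                       (join-splitAt n₁ m p) (join-splitAt n₁ m q)
                       (wedge-geodesic (splitAt n₁ p) (splitAt n₁ q))

module Weights where
  open import Algebra.Bundles using (CommutativeRing)
  import Data.Integer as ℤ
  import Data.Integer.Properties as ℤ
  open import Data.Nat.Coprimality using (1-coprimeTo) renaming (sym to coprime-sym)
  open import Data.Rational using (ℚ; mkℚ; 0ℚ; 1ℚ; _+_; _*_; -_; 1/_; _≤_; _<_; NonZero; positive; nonNegative)
  open import Data.Rational.Properties
  open import Data.Rational.Solver using (module +-*-Solver)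
  open +-*-Solver using (solve; _:+_; _:*_; :-_; _:=_)
  open import Algebra.Properties.Semiring.Sum (CommutativeRing.semiring +-*-commutativeRing)
    using (sum; sum-cong-≗; ∑-distrib-+; *-distribˡ-sum; *-distribʳ-sum; sum-remove; sum-replicate-zero)
  open import Data.Sum using (map₁)
  open ≡-Reasoning

  sumℚ≡sum : ∀ {n} (f : Fin n → ℚ) → sumℚ f ≡ sum f
  sumℚ≡sum {zero}  f = refl
  sumℚ≡sum {suc n} f = cong (f zero +_) (sumℚ≡sum (f ∘ suc))

  curvature-rowSum : ∀ {n} {D : Fin n → Fin n → ℕ} {w} → IsCurvature D w →
    ∀ i → sum (λ j → ℕtoℚ (D i j) * w j) ≡ ℕtoℚ n
  curvature-rowSum {D = D} {w} curv i = trans (sym (sumℚ≡sum (λ j → ℕtoℚ (D i j) * w j))) (curv i)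

  -- ℕtoℚ k is stuck on a gcd for a variable k; in canonical form, _+_ computes.
  ℕtoℚ≡mkℚ : ∀ k → ℕtoℚ k ≡ mkℚ (ℤ.+ k) 0 (coprime-sym (1-coprimeTo k))
  ℕtoℚ≡mkℚ k = normalize-coprime (coprime-sym (1-coprimeTo k))

  ℕtoℚ-+ : ∀ a b → ℕtoℚ (a ℕ.+ b) ≡ ℕtoℚ a + ℕtoℚ b
  ℕtoℚ-+ a b rewrite ℕtoℚ≡mkℚ a | ℕtoℚ≡mkℚ b =
    /-cong (trans (ℤ.pos-+ a b) (sym (cong₂ ℤ._+_ (ℤ.*-identityʳ (ℤ.+ a)) (ℤ.*-identityʳ (ℤ.+ b))))) refl

  ℕtoℚ-nonneg : ∀ k → 0ℚ ≤ ℕtoℚ k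
  ℕtoℚ-nonneg k = nonNegative⁻¹ _ {{normalize-nonNeg k 1}}

  ℕtoℚ-pos : ∀ k → 0ℚ < ℕtoℚ (suc k)
  ℕtoℚ-pos k = positive⁻¹ _ {{normalize-pos (suc k) 1}}

  *-nonneg : ∀ {p q} → 0ℚ ≤ p → 0ℚ ≤ q → 0ℚ ≤ p * q
  *-nonneg {p} {q} 0≤p 0≤q =
    nonNegative⁻¹ _ {{nonNeg*nonNeg⇒nonNeg p {{nonNegative 0≤p}} q {{nonNegative 0≤q}}}}

  *-pos : ∀ {p q} → 0ℚ < p → 0ℚ < q → 0ℚ < p * q
  *-pos {p} {q} 0<p 0<q = positive⁻¹ _ {{pos*pos⇒pos p {{positive 0<p}} q {{positive 0<q}}}}

  ∃-nonneg-quotient : ∀ {N d} → 0ℚ ≤ N → 0ℚ < d → ∃ λ t → 0ℚ ≤ t × t * d ≡ N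
  ∃-nonneg-quotient {N} {d} 0≤N 0<d = N * 1/ d , *-nonneg 0≤N (<⇒≤ 0<1/d) , N/d*d≡N
    where
    instance
      d≢0 : NonZero d
      d≢0 = pos⇒nonZero d {{positive 0<d}}
    0<1/d : 0ℚ < 1/ d
    0<1/d = positive⁻¹ _ {{1/pos⇒pos d {{positive 0<d}}}}
    N/d*d≡N : N * 1/ d * d ≡ N
    N/d*d≡N = trans (*-assoc N (1/ d) d) (trans (cong (N *_) (*-inverseˡ d)) (*-identityʳ N))

  sum-nonneg : ∀ {n} {f : Fin n → ℚ} → (∀ i → 0ℚ ≤ f i) → 0ℚ ≤ sum f
  sum-nonneg {zero}  _   = ≤-refl
  sum-nonneg {suc n} f≥0 = +-mono-≤ (f≥0 zero) (sum-nonneg (f≥0 ∘ suc))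

  term≤sum : ∀ {n} {f : Fin n → ℚ} → (∀ i → 0ℚ ≤ f i) → ∀ i → f i ≤ sum f
  term≤sum {f = f} f≥0 zero =
    subst (_≤ sum f) (+-identityʳ (f zero)) (+-monoʳ-≤ (f zero) (sum-nonneg (f≥0 ∘ suc)))
  term≤sum {f = f} f≥0 (suc i) =
    subst (_≤ sum f) (+-identityˡ (f (suc i))) (+-mono-≤ (f≥0 zero) (term≤sum (f≥0 ∘ suc) i))

  curvature-mass-pos : ∀ {n} {D : Fin n → Fin n → ℕ} {w : Fin n → ℚ} → Fin n → (∀ j → 0ℚ ≤ w j) →
    IsCurvature D w → 0ℚ < sum w
  curvature-mass-pos {suc k} {D} {w} i w≥0 curv with sum w ≤? 0ℚ
  ... | no  W≰0 = ≰⇒> W≰0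
  ... | yes W≤0 =
    contradiction (trans (sym (curvature-rowSum {D = D} {w} curv i)) rowSum≡0) (≢-sym (<⇒≢ (ℕtoℚ-pos k)))
    where
    w≡0 : ∀ j → w j ≡ 0ℚ
    w≡0 j = ≤-antisym (≤-trans (term≤sum w≥0 j) W≤0) (w≥0 j)
    rowSum≡0 : sum (λ j → ℕtoℚ (D i j) * w j) ≡ 0ℚ
    rowSum≡0 = trans (sum-cong-≗ (λ j → trans (cong (ℕtoℚ (D i j) *_) (w≡0 j)) (*-zeroʳ (ℕtoℚ (D i j)))))
                     (sum-replicate-zero (suc k))

  rowSum-scale : ∀ {n} {D : Fin n → Fin n → ℕ} {w : Fin n → ℚ} {c} α →
    (∀ i → sum (λ j → ℕtoℚ (D i j) * w j) ≡ c) → ∀ i → sum (λ j → ℕtoℚ (D i j) * (α * w j)) ≡ α * c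
  rowSum-scale {D = D} {w} {c} α rowSum i = begin
    sum (λ j → ℕtoℚ (D i j) * (α * w j)) ≡⟨ sum-cong-≗ (λ j → *-swap (ℕtoℚ (D i j)) α (w j)) ⟩
    sum (λ j → α * (ℕtoℚ (D i j) * w j)) ≡⟨ *-distribˡ-sum α (λ j → ℕtoℚ (D i j) * w j) ⟨
    α * sum (λ j → ℕtoℚ (D i j) * w j)   ≡⟨ cong (α *_) (rowSum i) ⟩
    α * c                                ∎
    where
    *-swap : ∀ x y z → x * (y * z) ≡ y * (x * z)
    *-swap = solve 3 (λ x y z → x :* (y :* z) := y :* (x :* z)) refl

  sum-splitAt : ∀ n₁ {m} (F : Fin n₁ ⊎ Fin m → ℚ) → sum (F ∘ splitAt n₁) ≡ sum (F ∘ inj₁) + sum (F ∘ inj₂)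
  sum-splitAt zero    F = sym (+-identityˡ _)
  sum-splitAt (suc n₁) F =
    trans (cong (F (inj₁ zero) +_) (sum-splitAt n₁ (F ∘ map₁ suc)))
          (sym (+-assoc (F (inj₁ zero)) _ _))

  δ : ∀ {n} → Fin n → Fin n → ℚ
  δ i j = if does (i ≟ᶠ j) then 1ℚ else 0ℚ

  δ-≢ : ∀ {n} {i j : Fin n} → i ≢ j → δ i j ≡ 0ℚ
  δ-≢ {i = i} {j} i≢j rewrite dec-false (i ≟ᶠ j) i≢j = refl

  sum-*-δ : ∀ {n} (f : Fin n → ℚ) i → sum (λ j → f j * δ i j) ≡ f i
  sum-*-δ {suc n} f zero = begin
    f zero * 1ℚ + sum (λ j → f (suc j) * 0ℚ)
      ≡⟨ cong₂ _+_ (*-identityʳ (f zero))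
                   (trans (sum-cong-≗ (λ j → *-zeroʳ (f (suc j)))) (sum-replicate-zero n)) ⟩
    f zero + 0ℚ
      ≡⟨ +-identityʳ (f zero) ⟩
    f zero ∎
  sum-*-δ {suc n} f (suc i) =
    trans (cong₂ _+_ (*-zeroʳ (f zero)) (sum-*-δ (f ∘ suc) i)) (+-identityˡ (f (suc i)))

  sum-*-+δ* : ∀ {n} (f g : Fin n → ℚ) i c →
    sum (λ j → f j * (g j + δ i j * c)) ≡ sum (λ j → f j * g j) + f i * c
  sum-*-+δ* f g i c = begin
    sum (λ j → f j * (g j + δ i j * c))
      ≡⟨ sum-cong-≗ (λ j → trans (*-distribˡ-+ (f j) (g j) (δ i j * c))
                                 (cong (f j * g j +_) (sym (*-assoc (f j) (δ i j) c)))) ⟩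
    sum (λ j → f j * g j + f j * δ i j * c)
      ≡⟨ ∑-distrib-+ (λ j → f j * g j) (λ j → f j * δ i j * c) ⟩
    sum (λ j → f j * g j) + sum (λ j → f j * δ i j * c)
      ≡⟨ cong (sum (λ j → f j * g j) +_) (*-distribʳ-sum c (λ j → f j * δ i j)) ⟨
    sum (λ j → f j * g j) + sum (λ j → f j * δ i j) * c
      ≡⟨ cong (λ x → sum (λ j → f j * g j) + x * c) (sum-*-δ f i) ⟩
    sum (λ j → f j * g j) + f i * c ∎

  module _ {n₁ m : ℕ} (u : Fin n₁) (v : Fin (suc m)) where
    open Wedge u v

    sum⊎ : (Fin n₁ ⊎ Fin m → ℚ) → ℚ
    sum⊎ F = sum (F ∘ inj₁) + sum (F ∘ inj₂)

    -- c carries ω₁ u minus the ω₂-mass of G₂ - v: then the π₁-pushforward is ω₁ and, when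
    -- the total masses agree, the π₂-pushforward is ω₂.
    wedgeWeight : (Fin n₁ → ℚ) → (Fin (suc m) → ℚ) → Fin n₁ ⊎ Fin m → ℚ
    wedgeWeight ω₁ ω₂ (inj₁ a) = ω₁ a + δ u a * (- sum (ω₂ ∘ punchIn v))
    wedgeWeight ω₁ ω₂ (inj₂ b) = ω₂ (punchIn v b)

    sum-π₁-wedgeWeight : ∀ ω₁ ω₂ (f : Fin n₁ → ℚ) →
      sum⊎ (λ s → f (π₁ s) * wedgeWeight ω₁ ω₂ s) ≡ sum (λ a → f a * ω₁ a)
    sum-π₁-wedgeWeight ω₁ ω₂ f = begin
      sum (λ a → f a * (ω₁ a + δ u a * - R)) + sum (λ b → f u * ω₂ (punchIn v b))
        ≡⟨ cong₂ _+_ (sum-*-+δ* f ω₁ u (- R)) (sym (*-distribˡ-sum (f u) (ω₂ ∘ punchIn v))) ⟩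
      sum (λ a → f a * ω₁ a) + f u * - R + f u * R
        ≡⟨ cancel (sum (λ a → f a * ω₁ a)) (f u) R ⟩
      sum (λ a → f a * ω₁ a) ∎
      where
      R : ℚ
      R = sum (ω₂ ∘ punchIn v)
      cancel : ∀ x y z → x + y * - z + y * z ≡ x
      cancel = solve 3 (λ x y z → x :+ y :* (:- z) :+ y :* z := x) refl

    sum-π₂-wedgeWeight : ∀ ω₁ ω₂ → sum ω₁ ≡ sum ω₂ → (g : Fin (suc m) → ℚ) →
      sum⊎ (λ s → g (π₂ s) * wedgeWeight ω₁ ω₂ s) ≡ sum (λ y → g y * ω₂ y)
    sum-π₂-wedgeWeight ω₁ ω₂ balanced g = begin
      sum (λ a → g v * (ω₁ a + δ u a * - R)) + S
        ≡⟨ cong (_+ S) (sum-*-+δ* (λ _ → g v) ω₁ u (- R)) ⟩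
      sum (λ a → g v * ω₁ a) + g v * - R + S
        ≡⟨ cong (λ x → x + g v * - R + S) (*-distribˡ-sum (g v) ω₁) ⟨
      g v * sum ω₁ + g v * - R + S
        ≡⟨ cong (λ x → g v * x + g v * - R + S) (trans balanced (sum-remove {i = v} ω₂)) ⟩
      g v * (ω₂ v + R) + g v * - R + S
        ≡⟨ cong (_+ S) (cancel (g v) (ω₂ v) R) ⟩
      g v * ω₂ v + S
        ≡⟨ sum-remove {i = v} (λ y → g y * ω₂ y) ⟨
      sum (λ y → g y * ω₂ y) ∎
      where
      R S : ℚ
      R = sum (ω₂ ∘ punchIn v)
      S = sum (λ b → g (punchIn v b) * ω₂ (punchIn v b))
      cancel : ∀ x y z → x * (y + z) + x * - z ≡ x * y
      cancel = solve 3 (λ x y z → x :* (y :+ z) :+ x :* (:- z) := x :* y) refl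

    wedgeWeight-rowSum : ∀ {D₁ D₂ ω₁ ω₂ c₁ c₂} →
      (∀ a → sum (λ b → ℕtoℚ (D₁ a b) * ω₁ b) ≡ c₁) → (∀ y → sum (λ z → ℕtoℚ (D₂ y z) * ω₂ z) ≡ c₂) →
      sum ω₁ ≡ sum ω₂ → ∀ s →
      sum (λ p → ℕtoℚ (wedgeDist D₁ D₂ s (splitAt n₁ p)) * wedgeWeight ω₁ ω₂ (splitAt n₁ p)) ≡ c₁ + c₂
    wedgeWeight-rowSum {D₁} {D₂} {ω₁} {ω₂} {c₁} {c₂} rowSum₁ rowSum₂ balanced s = begin
      sum (λ p → ℕtoℚ (wedgeDist D₁ D₂ s (splitAt n₁ p)) * w (splitAt n₁ p))
        ≡⟨ sum-cong-≗ (split ∘ splitAt n₁) ⟩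
      sum (λ p → A (splitAt n₁ p) + B (splitAt n₁ p))
        ≡⟨ ∑-distrib-+ (A ∘ splitAt n₁) (B ∘ splitAt n₁) ⟩
      sum (A ∘ splitAt n₁) + sum (B ∘ splitAt n₁)
        ≡⟨ cong₂ _+_ (sum-splitAt n₁ A) (sum-splitAt n₁ B) ⟩
      sum⊎ A + sum⊎ B
        ≡⟨ cong₂ _+_ (sum-π₁-wedgeWeight ω₁ ω₂ (λ a → ℕtoℚ (D₁ (π₁ s) a)))
                     (sum-π₂-wedgeWeight ω₁ ω₂ balanced (λ y → ℕtoℚ (D₂ (π₂ s) y))) ⟩
      sum (λ a → ℕtoℚ (D₁ (π₁ s) a) * ω₁ a) + sum (λ y → ℕtoℚ (D₂ (π₂ s) y) * ω₂ y)
        ≡⟨ cong₂ _+_ (rowSum₁ (π₁ s)) (rowSum₂ (π₂ s)) ⟩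
      c₁ + c₂ ∎
      where
      w : Fin n₁ ⊎ Fin m → ℚ
      w = wedgeWeight ω₁ ω₂
      A B : Fin n₁ ⊎ Fin m → ℚ
      A t = ℕtoℚ (D₁ (π₁ s) (π₁ t)) * w t
      B t = ℕtoℚ (D₂ (π₂ s) (π₂ t)) * w t
      split : ∀ t → ℕtoℚ (wedgeDist D₁ D₂ s t) * w t ≡ A t + B t
      split t = trans (cong (_* w t) (ℕtoℚ-+ (D₁ (π₁ s) (π₁ t)) (D₂ (π₂ s) (π₂ t))))
                      (*-distribʳ-+ (w t) (ℕtoℚ (D₁ (π₁ s) (π₁ t))) (ℕtoℚ (D₂ (π₂ s) (π₂ t))))

    wedgeWeight-nonneg : ∀ {ω₁ ω₂} → (∀ a → 0ℚ ≤ ω₁ a) → (∀ y → 0ℚ ≤ ω₂ y) →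
      ∀ s → s ≢ inj₁ u → 0ℚ ≤ wedgeWeight ω₁ ω₂ s
    wedgeWeight-nonneg {ω₁} {ω₂} ω₁≥0 _ (inj₁ a) a≢u = subst (0ℚ ≤_) (sym away-from-u) (ω₁≥0 a)
      where
      c : ℚ
      c = - sum (ω₂ ∘ punchIn v)
      away-from-u : ω₁ a + δ u a * c ≡ ω₁ a
      away-from-u = begin
        ω₁ a + δ u a * c ≡⟨ cong (λ x → ω₁ a + x * c) (δ-≢ (a≢u ∘ cong inj₁ ∘ sym)) ⟩
        ω₁ a + 0ℚ * c    ≡⟨ cong (ω₁ a +_) (*-zeroˡ c) ⟩
        ω₁ a + 0ℚ        ≡⟨ +-identityʳ (ω₁ a) ⟩
        ω₁ a             ∎
    wedgeWeight-nonneg _ ω₂≥0 (inj₂ b) _ = ω₂≥0 (punchIn v b)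

  ∃-balanced-scaling : ∀ {W₁ W₂ n₁ n₂ N} → 0ℚ < W₁ → 0ℚ ≤ W₂ → 0ℚ ≤ n₁ → 0ℚ < n₂ → 0ℚ ≤ N →
    ∃ λ α → ∃ λ β → 0ℚ ≤ α × 0ℚ ≤ β × α * W₁ ≡ β * W₂ × α * n₁ + β * n₂ ≡ N
  ∃-balanced-scaling {W₁} {W₂} {n₁} {n₂} 0<W₁ 0≤W₂ 0≤n₁ 0<n₂ 0≤N
    with ∃-nonneg-quotient 0≤N (+-mono-≤-< (*-nonneg 0≤W₂ 0≤n₁) (*-pos 0<W₁ 0<n₂))
  ... | t , 0≤t , t*den≡N =
    t * W₂ , t * W₁ , *-nonneg 0≤t 0≤W₂ , *-nonneg 0≤t (<⇒≤ 0<W₁) ,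
    swap t W₂ W₁ , trans (factor t W₂ n₁ W₁ n₂) t*den≡N
    where
    swap : ∀ t x y → t * x * y ≡ t * y * x
    swap = solve 3 (λ t x y → t :* x :* y := t :* y :* x) refl
    factor : ∀ t a b c d → t * a * b + t * c * d ≡ t * (a * b + c * d)
    factor = solve 5 (λ t a b c d → t :* a :* b :+ t :* c :* d := t :* (a :* b :+ c :* d)) refl

  module _ {n₁ m} {D₁ : Fin n₁ → Fin n₁ → ℕ} {D₂ : Fin (suc m) → Fin (suc m) → ℕ}
    {DH : Fin (n₁ ℕ.+ m) → Fin (n₁ ℕ.+ m) → ℕ} {w₁ : Fin n₁ → ℚ} {w₂ : Fin (suc m) → ℚ}
    (u : Fin n₁) (v : Fin (suc m))
    (curv₁ : IsCurvature D₁ w₁) (w₁≥0 : ∀ a → 0ℚ ≤ w₁ a)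
    (curv₂ : IsCurvature D₂ w₂) (w₂≥0 : ∀ y → 0ℚ ≤ w₂ y)
    (DH≡wedgeDist : ∀ p q → DH p q ≡ Wedge.wedgeDist u v D₁ D₂ (splitAt n₁ p) (splitAt n₁ q)) where

    scaled-glue-curvature : ∀ α β → 0ℚ ≤ α → 0ℚ ≤ β → α * sum w₁ ≡ β * sum w₂ →
      α * ℕtoℚ n₁ + β * ℕtoℚ (suc m) ≡ ℕtoℚ (n₁ ℕ.+ m) →
      ∃ λ (w : Fin (n₁ ℕ.+ m) → ℚ) → IsCurvature DH w × (∀ x → x ≢ glueVertex m u → 0ℚ ≤ w x)
    scaled-glue-curvature α β 0≤α 0≤β αW₁≡βW₂ αn₁+βn₂≡N = w ∘ splitAt n₁ , curvature , nonneg
      where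
      ω₁ : Fin n₁ → ℚ
      ω₁ a = α * w₁ a
      ω₂ : Fin (suc m) → ℚ
      ω₂ y = β * w₂ y
      w : Fin n₁ ⊎ Fin m → ℚ
      w = wedgeWeight u v ω₁ ω₂
      balanced : sum ω₁ ≡ sum ω₂
      balanced = trans (sym (*-distribˡ-sum α w₁)) (trans αW₁≡βW₂ (*-distribˡ-sum β w₂))
      curvature : IsCurvature DH (w ∘ splitAt n₁)
      curvature i = begin
        sumℚ (λ p → ℕtoℚ (DH i p) * w (splitAt n₁ p))
          ≡⟨ sumℚ≡sum (λ p → ℕtoℚ (DH i p) * w (splitAt n₁ p)) ⟩
        sum (λ p → ℕtoℚ (DH i p) * w (splitAt n₁ p))
          ≡⟨ sum-cong-≗ (λ p → cong (λ d → ℕtoℚ d * w (splitAt n₁ p)) (DH≡wedgeDist i p)) ⟩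
        sum (λ p → ℕtoℚ (Wedge.wedgeDist u v D₁ D₂ (splitAt n₁ i) (splitAt n₁ p)) * w (splitAt n₁ p))
          ≡⟨ wedgeWeight-rowSum u v {D₁} {D₂} {ω₁} {ω₂}
               (rowSum-scale {D = D₁} {w₁} α (curvature-rowSum {D = D₁} {w₁} curv₁))
               (rowSum-scale {D = D₂} {w₂} β (curvature-rowSum {D = D₂} {w₂} curv₂))
               balanced (splitAt n₁ i) ⟩
        α * ℕtoℚ n₁ + β * ℕtoℚ (suc m)
          ≡⟨ αn₁+βn₂≡N ⟩
        ℕtoℚ (n₁ ℕ.+ m) ∎
      nonneg : ∀ x → x ≢ glueVertex m u → 0ℚ ≤ w (splitAt n₁ x)
      nonneg x x≢c =
        wedgeWeight-nonneg u v {ω₁} {ω₂} (λ a → *-nonneg 0≤α (w₁≥0 a)) (λ y → *-nonneg 0≤β (w₂≥0 y))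
          (splitAt n₁ x) (λ eq → x≢c (sym (splitAt⁻¹-↑ˡ eq)))

    glue-curvature :
      ∃ λ (w : Fin (n₁ ℕ.+ m) → ℚ) → IsCurvature DH w × (∀ x → x ≢ glueVertex m u → 0ℚ ≤ w x)
    glue-curvature =
      let α , β , 0≤α , 0≤β , αW₁≡βW₂ , αn₁+βn₂≡N =
            ∃-balanced-scaling (curvature-mass-pos {D = D₁} u w₁≥0 curv₁) (sum-nonneg w₂≥0)
              (ℕtoℚ-nonneg n₁) (ℕtoℚ-pos m) (ℕtoℚ-nonneg (n₁ ℕ.+ m))
      in scaled-glue-curvature α β 0≤α 0≤β αW₁≡βW₂ αn₁+βn₂≡N

open import Data.Nat using (_+_)
open import Data.Rational using (ℚ; 0ℚ; _≤_)
open Walks using (distanceMatrix-unique)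
open GlueDistance using (glue-isDistanceMatrix)
open Weights using (glue-curvature)

theorem3 : ∀ {n₁ m : ℕ} (G₁ : Graph n₁) (G₂ : Graph (suc m))
    → IsSimple G₁ → IsSimple G₂ → Connected G₁ → Connected G₂
    → (D₁ : Fin n₁ → Fin n₁ → ℕ) → IsDistanceMatrix G₁ D₁
    → (D₂ : Fin (suc m) → Fin (suc m) → ℕ) → IsDistanceMatrix G₂ D₂
    → (w₁ : Fin n₁ → ℚ) → (∀ x → 0ℚ ≤ w₁ x) → IsCurvature D₁ w₁
    → (w₂ : Fin (suc m) → ℚ) → (∀ x → 0ℚ ≤ w₂ x) → IsCurvature D₂ w₂
    → (u : Fin n₁) (v : Fin (suc m))
    → (DH : Fin (n₁ + m) → Fin (n₁ + m) → ℕ) → IsDistanceMatrix (glue G₁ G₂ u v) DH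
    → ∃ λ (w : Fin (n₁ + m) → ℚ) →
        IsCurvature DH w × (∀ x → x ≢ glueVertex m u → 0ℚ ≤ w x)
-- Connectedness is implied by the distance matrices; of simplicity, only that G₂ has no loops is used.
theorem3 G₁ G₂ _ (_ , loopless₂) _ _ D₁ isD₁ D₂ isD₂ w₁ w₁≥0 curv₁ w₂ w₂≥0 curv₂ u v DH isDH =
  glue-curvature {D₁ = D₁} {D₂} {DH} {w₁} {w₂} u v curv₁ w₁≥0 curv₂ w₂≥0
    (distanceMatrix-unique isDH (glue-isDistanceMatrix G₁ G₂ u v loopless₂ isD₁ isD₂))
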